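{- For every $n\ge1$ and every permutation $\pi\in\mathfrak S_n$, $\varphi(\pi)=\varepsilon(h(w(\pi)))$, where $w(\pi)=\pi_n\cdots\pi_1$ is the reversal of $\pi$.
   Context: $\mathfrak S_n$ is the symmetric group on $[n]$ in one-line notation; $\mathfrak S_0=\{\emptyset\}$. For $n\ge1$, $Y_n$ is the set of planar binary trees with $n$ internal nodes ($n+1$ leaves ordered left to right); $Y_0=\{\ast\}$, the trivial one-vertex tree. $T_1\vee T_2$ is the tree with a new root with left subtree $T_1$ and right subtree $T_2$. $\mathrm{std}(a)$ is the standardization of a word $a$ of distinct integers ($\mathrm{std}(\emptyset)=\emptyset$). $a^{<x}$ (resp. $a^{>x}$) is the subsequence of entries of $a$ strictly less (resp. greater) than $x$, in the original order. Define $\varphi:\mathfrak S_n\to Y_n$ by $\varphi(\emptyset)=\ast$ and, for $n>0$, $\varphi(\pi)=\varphi(\mathrm{std}(\pi^{<\pi_n}))\vee\varphi(\mathrm{std}(\pi^{>\pi_n}))$. Indexed terms: $\mathcal L^I$ is generated by symbols $\mathbf 2^k$ ($k$ a positive integer) of arity $2$, and for terms $\mathbf A,\mathbf B$ and $1\le m\le|\mathbf A|$ the term $\mathbf A\circ_m\mathbf B$ of arity $|\mathbf A|+|\mathbf B|-1$; no index occurs twice in a term. The evaluation $\varepsilon$ forgets indices, sends $\mathbf 2^k$ to the 2-corolla and $\mathbf A\circ_m\mathbf B$ to the tree obtained by grafting the root of $\varepsilon(\mathbf B)$ onto the $m$-th leaf of $\varepsilon(\mathbf A)$. Head-insertion encoding: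 for a word $a=a_1\cdots a_n$ of distinct positive integers, $h(a_1)=\mathbf 2^{a_1}$ and $h(a)=h(a_1\cdots a_{n-1})\circ_r\mathbf 2^{a_n}$ with $r=1+|\{j<n:a_j<a_n\}|$ for $n>1$. -}

module Defs where

open import Data.Nat using (ℕ; zero; suc; _+_; _∸_; _<_; _>_; _≤ᵇ_)
open import Data.Nat.Properties using (_<?_)
open import Data.Bool using (if_then_else_)
open import Data.List using (List; []; _∷_; _++_; [_]; length; filter; map; upTo; reverse; last)
open import Data.Maybe using (Maybe; just; nothing)
open import Data.List.Relation.Binary.Permutation.Propositional using (_↭_)

-- One-line notation: π ∈ 𝔖ₙ  iff  π is a rearrangement of the word 1 2 ⋯ n.
IsPerm : ℕ → List ℕ → Set
IsPerm n π = π ↭ map suc (upTo n)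

-- Planar binary trees; leaf is the trivial tree ∗, node T₁ T₂ = T₁ ∨ T₂.
data Tree : Set where
  leaf : Tree
  node : Tree → Tree → Tree

below above : ℕ → List ℕ → List ℕ
below x a = filter (_<? x) a
above x a = filter (x <?_) a

std : List ℕ → List ℕ
std a = map (λ x → suc (length (below x a))) a

-- φ, defined with a fuel argument (fuel = length of the word suffices,
-- since both std(π^{<πₙ}) and std(π^{>πₙ}) are strictly shorter).
φ-fuel : ℕ → List ℕ → Tree
φ-fuel zero    _ = leaf
φ-fuel (suc k) π with last π
... | nothing = leaf
... | just x  = node (φ-fuel k (std (below x π))) (φ-fuel k (std (above x π)))

φ : List ℕ → Tree
φ π = φ-fuel (length π) π

-- Indexed terms: two k = 𝟐^k,  A ∘[ m ] B = A ∘_m B.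
data Term : Set where
  two  : ℕ → Term
  _∘[_]_ : Term → ℕ → Term → Term

leaves : Tree → ℕ
leaves leaf       = 1
leaves (node l r) = leaves l + leaves r

-- graft S onto the m-th leaf (1-indexed, left to right) of T
graft : Tree → ℕ → Tree → Tree
graft leaf m S = if m ≤ᵇ 1 then (if 1 ≤ᵇ m then S else leaf) else leaf
graft (node l r) m S =
  if m ≤ᵇ leaves l then node (graft l m S) r
  else node l (graft r (m ∸ leaves l) S)

ε : Term → Tree
ε (two _)      = node leaf leaf
ε (A ∘[ m ] B) = graft (ε A) m (ε B)

-- head-insertion encoding; h(a) for a = a₁ ⋯ aₙ processes a₂,…,aₙ in order.
-- pre is the already processed prefix a₁ ⋯ a_{j-1}.
h-go : Term → List ℕ → List ℕ → Term
h-go t pre []       = t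
h-go t pre (x ∷ xs) = h-go (t ∘[ suc (length (below x pre)) ] two x) (pre ++ [ x ]) xs

h : List ℕ → Maybe Term
h []       = nothing
h (a ∷ as) = just (h-go (two a) [ a ] as)

-- Both sides are the shape of the binary search tree of the word w(π), read from left
-- to right: its first letter is the root, the smaller letters build the left subtree and
-- the larger ones the right subtree. For φ this is the defining recursion, since the last
-- letter of π is the first letter of w(π) and standardisation preserves the relative order
-- of letters, hence the shape. For h, the leaves of a search tree of k distinct letters
-- are, from left to right, the k + 1 gaps between them; so grafting a corolla on leaf
-- number 1 + #{earlier letters smaller than x} is leaf insertion of x.
module Submission where

open import Defs
open import Data.Nat using (ℕ; _≤_)
open import Data.List using (List; reverse)
open import Data.Maybe using (Maybe; just; map)
open import Relation.Binary.PropositionalEquality using (_≡_)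

open import Level using (Level; 0ℓ)
open import Data.Bool using (true; false)
open import Data.Empty using (⊥-elim)
open import Data.Nat using (zero; suc; _+_; _<_; _≤ᵇ_; s≤s)
open import Data.Nat.Properties
open import Data.List using ([]; _∷_; _++_; [_]; _∷ʳ_; length; filter; last; upTo)
open import Data.List.Properties
  using (filter-accept; filter-reject; filter-notAll; filter-++; ++-identityʳ; ++-assoc; length-filter;
         unfold-reverse; reverse-map; reverse-involutive; length-reverse; length-map; length-upTo)
open import Data.List.Membership.Propositional using (_∈_; _∉_)
open import Data.List.Membership.Propositional.Properties using (∈-++⁺ʳ; ∈-filter⁺; ∈-filter⁻)
open import Data.List.Relation.Unary.All as All using (All; []; _∷_)
import Data.List.Relation.Unary.All.Properties as All
open import Data.List.Relation.Unary.Any as Any using (here; there)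
open import Data.List.Relation.Unary.Any.Properties using (reverse⁺)
open import Data.List.Relation.Unary.AllPairs using ([]; _∷_)
open import Data.List.Relation.Unary.Unique.Propositional using (Unique)
open import Data.List.Relation.Unary.Unique.Propositional.Properties
  using (filter⁺; map⁺; upTo⁺; Unique[x∷xs]⇒x∉xs)
open import Data.List.Relation.Binary.Permutation.Propositional using (↭⇒↭ₛ; ↭-sym)
open import Data.List.Relation.Binary.Permutation.Propositional.Properties using (↭-length; ↭-reverse)
open import Data.List.Relation.Binary.Permutation.Setoid.Properties using (Unique-resp-↭)
open import Relation.Binary.PropositionalEquality
  using (refl; sym; trans; cong; cong₂; subst; setoid; module ≡-Reasoning)
open import Relation.Binary.Definitions using (tri<; tri≈; tri>)
open import Relation.Nullary using (¬_; yes; no)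
open import Relation.Unary using (Pred; Decidable)
open import Function using (_∘′_)
open import Data.Product using (proj₁)
import Data.List as List

private
  variable
    a p q d : Level
    A B : Set a

module _ {P : Pred A p} (P? : Decidable P) where

  filter-∷ʳ-accept : ∀ xs {x} → P x → filter P? (xs ∷ʳ x) ≡ filter P? xs ∷ʳ x
  filter-∷ʳ-accept xs px = trans (filter-++ P? xs _) (cong (filter P? xs ++_) (filter-accept P? px))

  filter-∷ʳ-reject : ∀ xs {x} → ¬ P x → filter P? (xs ∷ʳ x) ≡ filter P? xs
  filter-∷ʳ-reject xs ¬px =
    trans (filter-++ P? xs _) (trans (cong (filter P? xs ++_) (filter-reject P? ¬px)) (++-identityʳ _))

  filter-reverse : ∀ xs → filter P? (reverse xs) ≡ reverse (filter P? xs)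
  filter-reverse []       = refl
  filter-reverse (x ∷ xs) with P? x
  ... | yes px = begin
    filter P? (reverse (x ∷ xs))  ≡⟨ cong (filter P?) (unfold-reverse x xs) ⟩
    filter P? (reverse xs ∷ʳ x)   ≡⟨ filter-∷ʳ-accept (reverse xs) px ⟩
    filter P? (reverse xs) ∷ʳ x   ≡⟨ cong (_∷ʳ x) (filter-reverse xs) ⟩
    reverse (filter P? xs) ∷ʳ x   ≡⟨ unfold-reverse x (filter P? xs) ⟨
    reverse (x ∷ filter P? xs)    ∎
    where open ≡-Reasoning
  ... | no ¬px = begin
    filter P? (reverse (x ∷ xs))  ≡⟨ cong (filter P?) (unfold-reverse x xs) ⟩
    filter P? (reverse xs ∷ʳ x)   ≡⟨ filter-∷ʳ-reject (reverse xs) ¬px ⟩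
    filter P? (reverse xs)        ≡⟨ filter-reverse xs ⟩
    reverse (filter P? xs)        ∎
    where open ≡-Reasoning

module _ {P : Pred B p} {Q : Pred A q} (P? : Decidable P) (Q? : Decidable Q)
         {D : Pred A d} {f : A → B}
         (Q⇒P : ∀ {x} → D x → Q x → P (f x)) (P⇒Q : ∀ {x} → D x → P (f x) → Q x) where

  filter-map-All : ∀ {xs} → All D xs → filter P? (List.map f xs) ≡ List.map f (filter Q? xs)
  filter-map-All []         = refl
  filter-map-All {x ∷ xs} (dx ∷ dxs) with Q? x
  ... | yes qx = trans (filter-accept P? (Q⇒P dx qx)) (cong (f x ∷_) (filter-map-All dxs))
  ... | no ¬qx = trans (filter-reject P? (¬qx ∘′ P⇒Q dx)) (filter-map-All dxs)

module _ {P : Pred A p} {Q : Pred A q} (P? : Decidable P) (Q? : Decidable Q) where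

  filter-filter-⊆ : (∀ {x} → P x → Q x) → ∀ xs → filter P? (filter Q? xs) ≡ filter P? xs
  filter-filter-⊆ P⊆Q []       = refl
  filter-filter-⊆ P⊆Q (x ∷ xs) with P? x in eq
  ... | yes px rewrite filter-accept Q? {xs = xs} (P⊆Q px) | eq = cong (x ∷_) (filter-filter-⊆ P⊆Q xs)
  ... | no ¬px with Q? x
  ...   | yes _ rewrite eq = filter-filter-⊆ P⊆Q xs
  ...   | no _  = filter-filter-⊆ P⊆Q xs

  filter-comm : ∀ xs → filter P? (filter Q? xs) ≡ filter Q? (filter P? xs)
  filter-comm []       = refl
  filter-comm (x ∷ xs) with P? x in eqP | Q? x in eqQ
  ... | yes _ | yes _ rewrite eqP | eqQ = cong (x ∷_) (filter-comm xs)
  ... | yes _ | no _  rewrite eqQ = filter-comm xs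
  ... | no _  | yes _ rewrite eqP = filter-comm xs
  ... | no _  | no _  = filter-comm xs

last-∷ʳ : ∀ (xs : List A) x → last (xs ∷ʳ x) ≡ just x
last-∷ʳ []           x = refl
last-∷ʳ (_ ∷ [])     x = refl
last-∷ʳ (_ ∷ y ∷ ys) x = last-∷ʳ (y ∷ ys) x

Unique-++⁻ˡ : ∀ (xs : List A) {ys} → Unique (xs ++ ys) → Unique xs
Unique-++⁻ˡ []       _              = []
Unique-++⁻ˡ (x ∷ xs) (x∉ys ∷ uxsys) = All.++⁻ˡ xs x∉ys ∷ Unique-++⁻ˡ xs uxsys

corolla : Tree
corolla = node leaf leaf

rank : ℕ → List ℕ → ℕ
rank x w = length (below x w)

below-below : ∀ {x y} → x < y → ∀ ws → below x (below y ws) ≡ below x ws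
below-below x<y = filter-filter-⊆ (_<? _) (_<? _) (λ w<x → <-trans w<x x<y)

rank+length-above : ∀ {x} ws → x ∉ ws → rank x ws + length (above x ws) ≡ length ws
rank+length-above []       _  = refl
rank+length-above {x} (w ∷ ws) x∉ with <-cmp w x
... | tri< w<x _ x≮w
  rewrite filter-accept (_<? x) {xs = ws} w<x | filter-reject (x <?_) {xs = ws} x≮w
  = cong suc (rank+length-above ws (x∉ ∘′ there))
... | tri≈ _ refl _ = ⊥-elim (x∉ (here refl))
... | tri> w≮x _ x<w
  rewrite filter-reject (_<? x) {xs = ws} w≮x | filter-accept (x <?_) {xs = ws} x<w
  = trans (+-suc _ _) (cong suc (rank+length-above ws (x∉ ∘′ there)))

rank-split : ∀ {x y} → y < x → ∀ ws → y ∉ ws → rank x ws ≡ rank y ws + rank x (above y ws)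
rank-split {x} {y} y<x ws y∉ws = begin
  rank x ws
    ≡⟨ rank+length-above (below x ws) (y∉ws ∘′ proj₁ ∘′ ∈-filter⁻ (_<? x)) ⟨
  rank y (below x ws) + length (above y (below x ws))
    ≡⟨ cong₂ _+_ (cong length (below-below y<x ws)) (cong length (filter-comm (y <?_) (_<? x) ws)) ⟩
  rank y ws + rank x (above y ws)
    ∎
  where open ≡-Reasoning

rank-strict : ∀ {y z ws} → y < z → y ∈ ws → rank y ws < rank z ws
rank-strict {y} {z} {ws} y<z y∈ws =
  subst (_< rank z ws) (cong length (below-below y<z ws))
    (filter-notAll (_<? y) (below z ws)
      (Any.map (λ { refl → <-irrefl refl }) (∈-filter⁺ (_<? z) y∈ws y<z)))

data BST : List ℕ → Tree → Set where
  empty : BST [] leaf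
  root  : ∀ {x xs L R} → BST (below x xs) L → BST (above x xs) R → BST (x ∷ xs) (node L R)

root′ : ∀ {x xs l r L R} → below x xs ≡ l → above x xs ≡ r →
        BST l L → BST r R → BST (x ∷ xs) (node L R)
root′ refl refl = root

BST-functional : ∀ {w S T} → BST w S → BST w T → S ≡ T
BST-functional empty        empty          = refl
BST-functional (root dL dR) (root dL′ dR′) =
  cong₂ node (BST-functional dL dL′) (BST-functional dR dR′)

BST-leaves : ∀ {w T} → Unique w → BST w T → leaves T ≡ suc (length w)
BST-leaves _ empty = refl
BST-leaves {x ∷ xs} u@(_ ∷ uxs) (root {L = L} {R} dL dR) = begin
  leaves L + leaves R
    ≡⟨ cong₂ _+_ (BST-leaves (filter⁺ (_<? x) uxs) dL) (BST-leaves (filter⁺ (x <?_) uxs) dR) ⟩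
  suc (rank x xs) + suc (length (above x xs))
    ≡⟨ cong suc (+-suc _ _) ⟩
  suc (suc (rank x xs + length (above x xs)))
    ≡⟨ cong (suc ∘′ suc) (rank+length-above xs (Unique[x∷xs]⇒x∉xs u)) ⟩
  suc (suc (length xs))
    ∎
  where open ≡-Reasoning

module _ {D : Pred ℕ d} {f : ℕ → ℕ} (f-mono : ∀ {y z} → D y → D z → y < z → f y < f z) where

  private
    f-reflects : ∀ {y z} → D y → D z → f y < f z → y < z
    f-reflects {y} {z} dy dz fy<fz with <-cmp y z
    ... | tri< y<z _ _ = y<z
    ... | tri≈ _ refl _ = ⊥-elim (<-irrefl refl fy<fz)
    ... | tri> _ _ z<y = ⊥-elim (<-asym fy<fz (f-mono dz dy z<y))

    below-map : ∀ {y zs} → D y → All D zs → below (f y) (List.map f zs) ≡ List.map f (below y zs)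
    below-map dy = filter-map-All (_<? _) (_<? _) (λ dz → f-mono dz dy) (λ dz → f-reflects dz dy)

    above-map : ∀ {y zs} → D y → All D zs → above (f y) (List.map f zs) ≡ List.map f (above y zs)
    above-map dy = filter-map-All (_ <?_) (_ <?_) (f-mono dy) (f-reflects dy)

  BST-map⁻ : ∀ {v w T} → All D w → v ≡ List.map f w → BST v T → BST w T
  BST-map⁻ {w = []}     []         refl empty       = empty
  BST-map⁻ {w = y ∷ ys} (dy ∷ dys) refl (root dL dR) =
    root (BST-map⁻ (All.filter⁺ (_<? y) dys) (below-map dy dys) dL)
         (BST-map⁻ (All.filter⁺ (y <?_) dys) (above-map dy dys) dR)

graft-node-≤ : ∀ {m l r S} → m ≤ leaves l → graft (node l r) m S ≡ node (graft l m S) r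
graft-node-≤ {m} {l} m≤l with m ≤ᵇ leaves l | ≤⇒≤ᵇ m≤l
... | true | _ = refl

graft-node-+ : ∀ {l r} m {S} → graft (node l r) (leaves l + suc m) S ≡ node l (graft r (suc m) S)
graft-node-+ {l} {r} m {S} with leaves l + suc m ≤ᵇ leaves l | ≤ᵇ⇒≤ (leaves l + suc m) (leaves l)
... | true  | l+m<l = ⊥-elim (m+1+n≰m (leaves l) (l+m<l _))
... | false | _     = cong (λ k → node l (graft r k S)) (m+n∸m≡n (leaves l) (suc m))

graft-rank-< : ∀ {x y ys L R S} → x < y → leaves L ≡ suc (rank y ys) →
               graft (node L R) (suc (rank x (y ∷ ys))) S
               ≡ node (graft L (suc (rank x (below y ys))) S) R
graft-rank-< {x} {y} {ys} {L} {R} {S} x<y |L| = begin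
  graft (node L R) (suc (rank x (y ∷ ys))) S
    ≡⟨ cong (λ v → graft (node L R) (suc (length v)) S) below-∷ ⟩
  graft (node L R) (suc (rank x (below y ys))) S
    ≡⟨ graft-node-≤ (subst (_ ≤_) (sym |L|) (s≤s (length-filter (_<? x) (below y ys)))) ⟩
  node (graft L (suc (rank x (below y ys))) S) R
    ∎
  where
  open ≡-Reasoning
  below-∷ : below x (y ∷ ys) ≡ below x (below y ys)
  below-∷ = trans (filter-reject (_<? x) (<-asym x<y)) (sym (below-below x<y ys))

graft-rank-> : ∀ {x y ys L R S} → y < x → y ∉ ys → leaves L ≡ suc (rank y ys) →
               graft (node L R) (suc (rank x (y ∷ ys))) S
               ≡ node L (graft R (suc (rank x (above y ys))) S)
graft-rank-> {x} {y} {ys} {L} {R} {S} y<x y∉ys |L| = begin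
  graft (node L R) (suc (rank x (y ∷ ys))) S
    ≡⟨ cong (λ k → graft (node L R) (suc k) S) rank-∷ ⟩
  graft (node L R) (suc (rank y ys) + suc (rank x (above y ys))) S
    ≡⟨ cong (λ k → graft (node L R) (k + suc (rank x (above y ys))) S) |L| ⟨
  graft (node L R) (leaves L + suc (rank x (above y ys))) S
    ≡⟨ graft-node-+ (rank x (above y ys)) ⟩
  node L (graft R (suc (rank x (above y ys))) S)
    ∎
  where
  open ≡-Reasoning
  rank-∷ : rank x (y ∷ ys) ≡ rank y ys + suc (rank x (above y ys))
  rank-∷ = begin
    rank x (y ∷ ys)                        ≡⟨ cong length (filter-accept (_<? x) y<x) ⟩
    suc (rank x ys)                        ≡⟨ cong suc (rank-split y<x ys y∉ys) ⟩
    suc (rank y ys + rank x (above y ys))  ≡⟨ +-suc _ _ ⟨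
    rank y ys + suc (rank x (above y ys))  ∎

BST-∷ʳ : ∀ {w x T} → Unique (w ∷ʳ x) → BST w T → BST (w ∷ʳ x) (graft T (suc (rank x w)) corolla)
BST-∷ʳ _ empty = root empty empty
BST-∷ʳ {y ∷ ys} {x} u@(_ ∷ uys∷ʳx) (root dL dR) with <-cmp x y | Unique-++⁻ˡ (y ∷ ys) u
... | tri< x<y _ y≮x | _ ∷ uys =
  subst (BST _) (sym (graft-rank-< x<y (BST-leaves (filter⁺ (_<? y) uys) dL)))
    (root′ below-∷ʳ (filter-∷ʳ-reject (y <?_) ys y≮x)
       (BST-∷ʳ (subst Unique below-∷ʳ (filter⁺ (_<? y) uys∷ʳx)) dL) dR)
  where
  below-∷ʳ : below y (ys ∷ʳ x) ≡ below y ys ∷ʳ x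
  below-∷ʳ = filter-∷ʳ-accept (_<? y) ys x<y
... | tri≈ _ refl _ | _ = ⊥-elim (Unique[x∷xs]⇒x∉xs u (∈-++⁺ʳ ys (here refl)))
... | tri> x≮y _ y<x | uyys@(_ ∷ uys) =
  subst (BST _)
    (sym (graft-rank-> y<x (Unique[x∷xs]⇒x∉xs uyys) (BST-leaves (filter⁺ (_<? y) uys) dL)))
    (root′ (filter-∷ʳ-reject (_<? y) ys x≮y) above-∷ʳ
       dL (BST-∷ʳ (subst Unique above-∷ʳ (filter⁺ (y <?_) uys∷ʳx)) dR))
  where
  above-∷ʳ : above y (ys ∷ʳ x) ≡ above y ys ∷ʳ x
  above-∷ʳ = filter-∷ʳ-accept (y <?_) ys y<x

h-go-BST : ∀ xs {t pre} → Unique (pre ++ xs) → BST pre (ε t) → BST (pre ++ xs) (ε (h-go t pre xs))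
h-go-BST []       {pre = pre} _ d = subst (λ w → BST w _) (sym (++-identityʳ pre)) d
h-go-BST (x ∷ xs) {t} {pre} u d =
  subst (λ w → BST w (ε (h-go t pre (x ∷ xs)))) (++-assoc pre [ x ] xs)
    (h-go-BST xs u′ (BST-∷ʳ (Unique-++⁻ˡ (pre ∷ʳ x) u′) d))
  where
  u′ : Unique ((pre ∷ʳ x) ++ xs)
  u′ = subst Unique (sym (++-assoc pre [ x ] xs)) u

h-BST : ∀ {w T} → Unique w → BST w T → 1 ≤ length w → map ε (h w) ≡ just T
h-BST {a ∷ as} u d _ = cong just (BST-functional (h-go-BST as u (root empty empty)) d)

φ-fuel-BST : ∀ k ρ → length ρ ≤ k → BST ρ (φ-fuel k (reverse ρ))
φ-fuel-BST zero    []      _          = empty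
φ-fuel-BST (suc k) []      _          = empty
φ-fuel-BST (suc k) (x ∷ ρ) (s≤s ρ≤k)
  rewrite unfold-reverse x ρ | last-∷ʳ (reverse ρ) x
  = root (subtree (_<? x) (<-irrefl refl)) (subtree (x <?_) (<-irrefl refl))
  where
  std-reverse : ∀ σ → length σ ≤ k → BST σ (φ-fuel k (std (reverse σ)))
  std-reverse σ σ≤k =
    BST-map⁻ (λ y∈ _ y<z → s≤s (rank-strict y<z y∈)) (All.tabulate reverse⁺) refl
      (subst (λ v → BST (List.map std-label σ) (φ-fuel k v)) (sym (reverse-map std-label σ))
        (φ-fuel-BST k (List.map std-label σ) (subst (_≤ k) (sym (length-map std-label σ)) σ≤k)))
    where
    std-label : ℕ → ℕ
    std-label y = suc (rank y (reverse σ))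

  subtree : ∀ {P : Pred ℕ 0ℓ} (P? : Decidable P) → ¬ P x →
            BST (filter P? ρ) (φ-fuel k (std (filter P? (reverse ρ ∷ʳ x))))
  subtree P? ¬Px rewrite filter-∷ʳ-reject P? (reverse ρ) ¬Px | filter-reverse P? ρ =
    std-reverse (filter P? ρ) (≤-trans (length-filter P? ρ) ρ≤k)

φ-BST : ∀ π → BST (reverse π) (φ π)
φ-BST π = subst (λ v → BST (reverse π) (φ-fuel (length π) v)) (reverse-involutive π)
            (φ-fuel-BST (length π) (reverse π) (≤-reflexive (length-reverse π)))

IsPerm⇒Unique : ∀ {n π} → IsPerm n π → Unique π
IsPerm⇒Unique {n} π↭ = Unique-resp-↭ (setoid ℕ) (↭⇒↭ₛ (↭-sym π↭)) (map⁺ suc-injective (upTo⁺ n))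

IsPerm⇒length : ∀ {n π} → IsPerm n π → length π ≡ n
IsPerm⇒length {n} π↭ = trans (↭-length π↭) (trans (length-map suc (upTo n)) (length-upTo n))

theorem4p10 : (n : ℕ) → 1 ≤ n → (π : List ℕ) → IsPerm n π →
  just (φ π) ≡ Data.Maybe.map ε (h (reverse π))
theorem4p10 n 1≤n π π∈𝔖ₙ = sym (h-BST unique-reverse (φ-BST π) nonempty)
  where
  unique-reverse : Unique (reverse π)
  unique-reverse = Unique-resp-↭ (setoid ℕ) (↭⇒↭ₛ (↭-sym (↭-reverse π))) (IsPerm⇒Unique π∈𝔖ₙ)

  nonempty : 1 ≤ length (reverse π)
  nonempty = subst (1 ≤_) (sym (trans (length-reverse π) (IsPerm⇒length π∈𝔖ₙ))) 1≤n
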